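{- Let $P$ be a finite diamond transitive thin poset. Then: (1) every closed interval $[x,y]$ of $P$ of length $2$ consists of exactly four elements $\{x,a,b,y\}$ with $x\lessdot a\lessdot y$ and $x\lessdot b\lessdot y$; (2) every closed interval $[x,y]$ of $P$ of length $3$ is of the following form: for some integer $n\ge 2$, $[x,y]=\{x,y,a_1,\dots,a_n,b_1,\dots,b_n\}$ (all distinct), where $x\lessdot a_i$ and $b_i\lessdot y$ for all $i$, and the cover relations between the elements $a_1,\dots,a_n$ (of rank $\mathrm{rk}(x)+1$) and $b_1,\dots,b_n$ (of rank $\mathrm{rk}(x)+2$) are exactly $a_i\lessdot b_i$ and $a_{i+1}\lessdot b_i$ for $i=1,\dots,n$, indices taken modulo $n$ (so the Hasse diagram between the two middle ranks is a single cycle of length $2n$).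
   Context: All posets are finite. A poset $P$ is graded if there is a function $\mathrm{rk}:P\to\mathbb{N}$ with $\mathrm{rk}(y)=\mathrm{rk}(x)+1$ whenever $x\lessdot y$ (a cover relation). The length of an interval $[x,y]$ is $\mathrm{rk}(y)-\mathrm{rk}(x)$. A graded poset is thin if every nonempty closed interval of length 2 has exactly 4 elements; such an interval $\{x,a,b,y\}$ ($x\lessdot a\lessdot y$, $x\lessdot b\lessdot y$) is called a diamond. A saturated chain from $x$ to $y$ is a sequence $x=x_0\lessdot x_1\lessdot\dots\lessdot x_k=y$. For a diamond $d=\{x,a,b,y\}$ and a saturated chain $C$, the diamond move $dC$ is defined as: if $x\lessdot a\lessdot y$ is a subchain of $C$, $dC=(C\setminus\{a\})\cup\{b\}$; if $x\lessdot b\lessdot y$ is a subchain of $C$, $dC=(C\setminus\{b\})\cup\{a\}$; otherwise $dC=C$. A thin poset $P$ is diamond transitive if for every $x\le y$ in $P$, any two saturated chains from $x$ to $y$ can be transformed into one another by a finite sequence of diamond moves (with diamonds of $P$). -}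

module Defs where

open import Level using (0ℓ)
open import Data.Nat using (ℕ; zero; suc; _+_; NonZero)
open import Data.Nat.DivMod using (_%_)
open import Data.Fin using (Fin; toℕ)
open import Data.List using (List; []; _∷_; _++_; length; filter; allFin)
open import Data.Product using (Σ; ∃; ∃-syntax; _×_; _,_)
open import Data.Sum using (_⊎_)
open import Relation.Nullary using (¬_)
open import Relation.Nullary.Decidable using (_×-dec_)
open import Relation.Binary using (Rel; IsDecPartialOrder)
open import Relation.Binary.PropositionalEquality using (_≡_; _≢_)
open import Relation.Binary.Construct.Closure.ReflexiveTransitive using (Star)

-- A finite poset: the carrier is Fin size (every finite poset is isomorphic
-- to one of these); the order is a decidable partial order w.r.t. _≡_.
record FinitePoset : Set₁ where
  field
    size : ℕ
    _≤_ : Rel (Fin size) 0ℓ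
    isDecPartialOrder : IsDecPartialOrder _≡_ _≤_

module Notions (P : FinitePoset) where
  open FinitePoset P public
  open IsDecPartialOrder isDecPartialOrder using (_≤?_)

  El : Set
  El = Fin size

  _<_ : El → El → Set
  x < y = x ≤ y × x ≢ y

  _⋖_ : El → El → Set
  x ⋖ y = x < y × (∀ z → x < z → z < y → Data.Empty.⊥)
    where import Data.Empty

  IsRankFunction : (El → ℕ) → Set
  IsRankFunction rk = ∀ x y → x ⋖ y → rk y ≡ suc (rk x)

  InInterval : El → El → El → Set
  InInterval x y z = x ≤ z × z ≤ y

  intervalSize : El → El → ℕ
  intervalSize x y = length (filter (λ z → (x ≤? z) ×-dec (z ≤? y)) (allFin size))

  Thin : (El → ℕ) → Set
  Thin rk = ∀ x y → x ≤ y → rk y ≡ 2 + rk x → intervalSize x y ≡ 4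

  Diamond : El → El → El → El → Set
  Diamond x a b y = x ⋖ a × a ⋖ y × x ⋖ b × b ⋖ y × a ≢ b

  data IsSatChain : El → El → List El → Set where
    single : ∀ x → IsSatChain x x (x ∷ [])
    step   : ∀ {x z y cs} → x ⋖ z → IsSatChain z y (z ∷ cs) →
             IsSatChain x y (x ∷ z ∷ cs)

  -- one (non-trivial) diamond move: replace the subchain x ⋖ a ⋖ y by
  -- x ⋖ b ⋖ y for a diamond {x,a,b,y}  (diamonds are symmetric in a,b,
  -- and moves that do not apply leave the chain unchanged, which is covered
  -- by reflexivity of the closure below)
  data DiamondMove : List El → List El → Set where
    move : ∀ pre post x a b y → Diamond x a b y →
           DiamondMove (pre ++ x ∷ a ∷ y ∷ post) (pre ++ x ∷ b ∷ y ∷ post)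

  DiamondTransitive : Set
  DiamondTransitive = ∀ x y → x ≤ y → ∀ C C' →
    IsSatChain x y C → IsSatChain x y C' → Star DiamondMove C C'

  LengthTwoShape : El → El → Set
  LengthTwoShape x y = Σ El λ a → Σ El λ b →
    x ⋖ a × a ⋖ y × x ⋖ b × b ⋖ y × a ≢ b ×
    (∀ z → InInterval x y z → z ≡ x ⊎ z ≡ a ⊎ z ≡ b ⊎ z ≡ y)

  -- conclusion (2): n = 2 + m ≥ 2, elements a_i, b_i indexed by Fin n
  -- (i.e. 0,…,n-1 instead of 1,…,n); a_i ⋖ b_j iff i = j or i ≡ j+1 (mod n)
  LengthThreeShape : El → El → Set
  LengthThreeShape x y = Σ ℕ λ m →
    let n = suc (suc m) in
    Σ (Fin n → El) λ a → Σ (Fin n → El) λ b →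
      (∀ i j → a i ≡ a j → i ≡ j) ×
      (∀ i j → b i ≡ b j → i ≡ j) ×
      (∀ i j → a i ≢ b j) ×
      (∀ i → x ≢ a i × x ≢ b i × y ≢ a i × y ≢ b i) ×
      (∀ i → x ⋖ a i) ×
      (∀ i → b i ⋖ y) ×
      (∀ i j → (a i ⋖ b j) → (toℕ i ≡ toℕ j ⊎ toℕ i ≡ suc (toℕ j) % n)) ×
      (∀ i j → (toℕ i ≡ toℕ j ⊎ toℕ i ≡ suc (toℕ j) % n) → a i ⋖ b j) ×
      (∀ z → InInterval x y z → z ≡ x ⊎ z ≡ y ⊎ (∃[ i ] z ≡ a i) ⊎ (∃[ i ] z ≡ b i))

  Conclusion : (El → ℕ) → Set
  Conclusion rk =
    (∀ x y → x ≤ y → rk y ≡ 2 + rk x → LengthTwoShape x y) ×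
    (∀ x y → x ≤ y → rk y ≡ 3 + rk x → LengthThreeShape x y)

module Submission where

-- Ranks strictly increase along < (a finite poset is well-founded in both
-- directions), so x < z with rk z = rk x + 1 is a cover.  (1) By thinness an
-- interval [x, y] of length 2 is a duplicate-free list of four elements; apart
-- from x and y it contains exactly two elements, which by their ranks are
-- covers.  (2) For [x, y] of length 3, view the Hasse diagram of its two middle
-- ranks as a graph.  By (1), applied to [a, y] and [x, b], every vertex has
-- degree two, and in such a finite graph the non-backtracking walk along an
-- edge closes up into a cycle forming a whole connected component.  The cycle
-- alternates between the two ranks, so it has length 2n with n ≥ 2; its even
-- and odd positions give the a_i and b_i.  A diamond move on a chain
-- x ⋖ u ⋖ v ⋖ y replaces u or v by a graph neighbour, so by diamond
-- transitivity every middle element lies on the cycle.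

open import Defs
open import Level using (0ℓ)
open import Data.Nat as ℕ using (ℕ; zero; suc; _+_; _*_; z≤n; s≤s; NonZero)
import Data.Nat.Properties as ℕₚ
open import Data.Nat.DivMod using (_%_; n%n≡0; m<n⇒m%n≡m; m%n<n; %-congˡ; %-congʳ; m%n*o≡m*o%[n*o])
open import Data.Fin using (Fin; toℕ; fromℕ<)
import Data.Fin.Properties as Finₚ
open import Data.List using (List; []; _∷_; length; filter; allFin)
open import Data.List.Membership.Propositional using (_∈_)
open import Data.List.Membership.Propositional.Properties using (∈-filter⁺; ∈-filter⁻; ∈-allFin)
open import Data.List.Relation.Unary.Unique.Propositional.Properties using (allFin⁺; filter⁺)
open import Data.List.Relation.Unary.Any using (here; there)
import Data.List.Relation.Unary.All as All
open import Data.List.Relation.Unary.AllPairs using ([]; _∷_)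
open import Data.List.Relation.Unary.Unique.Propositional using (Unique)
open import Data.Product using (Σ; ∃; ∃₂; _×_; _,_; proj₁; proj₂)
import Data.Product as Product
open import Data.Sum using (_⊎_; inj₁; inj₂)
import Data.Sum as Sum
open import Data.Empty using (⊥-elim)
open import Function using (id; _∘_; flip)
open import Relation.Nullary using (¬_; Dec; yes; no; ¬?)
open import Relation.Nullary.Decidable using (_×-dec_)
open import Relation.Binary using (Rel; Symmetric; IsDecPartialOrder)
import Relation.Binary.Construct.NonStrictToStrict as ToStrict
open import Induction.WellFounded using (Acc; acc)
open import Data.Fin.Induction using (po-wellFounded; po-noetherian)
open import Relation.Binary.Construct.Closure.ReflexiveTransitive using (Star; ε; _◅_)
open import Relation.Binary.PropositionalEquality
  using (_≡_; _≢_; refl; sym; trans; cong; subst; ≢-sym; module ≡-Reasoning)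

module _ {A : Set} where

  record Removal (L : List A) (x : A) : Set where
    field
      rest    : List A
      shorter : length L ≡ suc (length rest)
      unique  : Unique rest
      covers  : ∀ {z} → z ∈ L → z ≡ x ⊎ z ∈ rest
      sound   : ∀ {z} → z ∈ rest → z ∈ L × z ≢ x

  remove : ∀ {L x} → Unique L → x ∈ L → Removal L x
  remove {x ∷ L} (x∉L ∷ L!) (here refl) = record
    { rest    = L
    ; shorter = refl
    ; unique  = L!
    ; covers  = λ { (here z≡x) → inj₁ z≡x ; (there z∈L) → inj₂ z∈L }
    ; sound   = λ z∈L → there z∈L , λ z≡x → All.lookup x∉L z∈L (sym z≡x)
    }
  remove {e ∷ L} (e∉L ∷ L!) (there x∈L) = record
    { rest    = e ∷ rest
    ; shorter = cong suc shorter
    ; unique  = All.tabulate (λ z∈rest → All.lookup e∉L (proj₁ (sound z∈rest))) ∷ unique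
    ; covers  = λ { (here z≡e) → inj₂ (here z≡e) ; (there z∈L) → Sum.map₂ there (covers z∈L) }
    ; sound   = λ { (here refl) → here refl , All.lookup e∉L x∈L
                  ; (there z∈rest) → Product.map₁ there (sound z∈rest) }
    }
    where open Removal (remove L! x∈L)

  two-others : ∀ {L x y} → Unique L → length L ≡ 4 → x ∈ L → y ∈ L → x ≢ y →
    ∃₂ λ a b → a ≢ b × (a ∈ L × a ≢ x × a ≢ y) × (b ∈ L × b ≢ x × b ≢ y) ×
               (∀ {z} → z ∈ L → z ≡ x ⊎ z ≡ a ⊎ z ≡ b ⊎ z ≡ y)
  two-others {L} {x} {y} L! |L|≡4 x∈L y∈L x≢y =
    pair R₂.rest (ℕₚ.suc-injective (ℕₚ.suc-injective |L|≡2+|R₂|)) R₂.unique member cover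
    where
    module R₁ = Removal (remove L! x∈L)
    y∈R₁ : y ∈ R₁.rest
    y∈R₁ with R₁.covers y∈L
    ... | inj₁ y≡x  = ⊥-elim (x≢y (sym y≡x))
    ... | inj₂ y∈R₁ = y∈R₁
    module R₂ = Removal (remove R₁.unique y∈R₁)
    |L|≡2+|R₂| : 4 ≡ suc (suc (length R₂.rest))
    |L|≡2+|R₂| = trans (sym |L|≡4) (trans R₁.shorter (cong suc R₂.shorter))

    member : ∀ {z} → z ∈ R₂.rest → z ∈ L × z ≢ x × z ≢ y
    member z∈R₂ = let z∈R₁ , z≢y = R₂.sound z∈R₂ ; z∈L , z≢x = R₁.sound z∈R₁
                  in z∈L , z≢x , z≢y

    cover : ∀ {z} → z ∈ L → z ≡ x ⊎ z ≡ y ⊎ z ∈ R₂.rest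
    cover z∈L = Sum.map₂ R₂.covers (R₁.covers z∈L)

    pair : ∀ R → 2 ≡ length R → Unique R →
      (∀ {z} → z ∈ R → z ∈ L × z ≢ x × z ≢ y) → (∀ {z} → z ∈ L → z ≡ x ⊎ z ≡ y ⊎ z ∈ R) →
      ∃₂ λ a b → a ≢ b × (a ∈ L × a ≢ x × a ≢ y) × (b ∈ L × b ≢ x × b ≢ y) ×
                 (∀ {z} → z ∈ L → z ≡ x ⊎ z ≡ a ⊎ z ≡ b ⊎ z ≡ y)
    pair (a ∷ b ∷ []) refl ((a≢b All.∷ All.[]) ∷ _) member cover =
      a , b , a≢b , member (here refl) , member (there (here refl)) , classify ∘ cover
      where
      classify : ∀ {z} → z ≡ x ⊎ z ≡ y ⊎ z ∈ a ∷ b ∷ [] → z ≡ x ⊎ z ≡ a ⊎ z ≡ b ⊎ z ≡ y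
      classify (inj₁ z≡x)                  = inj₁ z≡x
      classify (inj₂ (inj₁ z≡y))           = inj₂ (inj₂ (inj₂ z≡y))
      classify (inj₂ (inj₂ (here z≡a)))    = inj₂ (inj₁ z≡a)
      classify (inj₂ (inj₂ (there (here z≡b)))) = inj₂ (inj₂ (inj₁ z≡b))

module _ {m : ℕ} (f : ℕ → Fin m) where

  InjectiveBelow : ℕ → Set
  InjectiveBelow K = ∀ {i j} → i ℕ.< K → j ℕ.< K → f i ≡ f j → i ≡ j

  record FirstRepeat : Set where
    field
      index     : ℕ
      injective : InjectiveBelow index
      earlier   : ℕ
      before    : earlier ℕ.< index
      revisits  : f earlier ≡ f index

  injective-or-repeat : ∀ K → InjectiveBelow (suc K) ⊎ FirstRepeat
  injective-or-repeat zero = inj₁ λ { (s≤s z≤n) (s≤s z≤n) _ → refl }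
  injective-or-repeat (suc K) with injective-or-repeat K
  ... | inj₂ repeat = inj₂ repeat
  ... | inj₁ injective with Finₚ.any? (λ (i : Fin (suc K)) → f (toℕ i) Finₚ.≟ f (suc K))
  ...   | yes (i , revisits) = inj₂ (record
          { index = suc K ; injective = injective ; earlier = toℕ i
          ; before = Finₚ.toℕ<n i ; revisits = revisits })
  ...   | no fresh = inj₁ extended
    where
    earlier-value : ∀ {i} → i ℕ.< suc K → f i ≢ f (suc K)
    earlier-value i<1+K eq = fresh (fromℕ< i<1+K , trans (cong f (Finₚ.toℕ-fromℕ< i<1+K)) eq)

    extended : InjectiveBelow (suc (suc K))
    extended i< j< eq with ℕₚ.m<1+n⇒m<n∨m≡n i< | ℕₚ.m<1+n⇒m<n∨m≡n j<
    ... | inj₁ i<1+K | inj₁ j<1+K = injective i<1+K j<1+K eq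
    ... | inj₂ refl  | inj₂ refl  = refl
    ... | inj₁ i<1+K | inj₂ refl  = ⊥-elim (earlier-value i<1+K eq)
    ... | inj₂ refl  | inj₁ j<1+K = ⊥-elim (earlier-value j<1+K (sym eq))

  first-repeat : FirstRepeat
  first-repeat with injective-or-repeat m
  ... | inj₂ repeat = repeat
  ... | inj₁ injective with Finₚ.pigeonhole (ℕₚ.n<1+n m) (f ∘ toℕ)
  ...   | i , j , i<j , eq = ⊥-elim (ℕₚ.<⇒≢ i<j (injective (Finₚ.toℕ<n i) (Finₚ.toℕ<n j) eq))

parity : ∀ p → ∃ λ i → p ≡ 2 * i ⊎ p ≡ suc (2 * i)
parity zero = 0 , inj₁ refl
parity (suc p) with parity p
... | i , inj₁ refl = i , inj₂ refl
... | i , inj₂ refl = suc i , inj₁ (sym (ℕₚ.*-suc 2 i))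

Consecutive : (D : ℕ) .{{_ : NonZero D}} → ℕ → ℕ → Set
Consecutive D p q = suc p % D ≡ q ⊎ suc q % D ≡ p

odd-below : ∀ {i n} → i ℕ.< n → suc (2 * i) ℕ.< 2 * n
odd-below {i} {n} i<n = subst (ℕ._≤ 2 * n) (ℕₚ.*-suc 2 i) (ℕₚ.*-monoʳ-≤ 2 i<n)

double-mod : ∀ a n .{{_ : NonZero n}} .{{_ : NonZero (2 * n)}} → 2 * a % (2 * n) ≡ 2 * (a % n)
double-mod a n = begin
  2 * a % (2 * n) ≡⟨ cong (_% (2 * n)) (ℕₚ.*-comm 2 a) ⟩
  a * 2 % (2 * n) ≡⟨ %-congʳ (ℕₚ.*-comm 2 n) ⟩
  a * 2 % (n * 2) ≡⟨ sym (m%n*o≡m*o%[n*o] a n 2) ⟩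
  a % n * 2       ≡⟨ ℕₚ.*-comm (a % n) 2 ⟩
  2 * (a % n)     ∎
  where
  open ≡-Reasoning
  instance _ = ℕₚ.m*n≢0 n 2

consecutive⇒halves : ∀ {D n i j} .{{_ : NonZero D}} .{{_ : NonZero n}} → D ≡ 2 * n → i ℕ.< n →
  Consecutive D (2 * i) (suc (2 * j)) → i ≡ j ⊎ i ≡ suc j % n
consecutive⇒halves {i = i} {j} refl i<n (inj₁ eq) =
  inj₁ (ℕₚ.*-cancelˡ-≡ i j 2 (ℕₚ.suc-injective (trans (sym (m<n⇒m%n≡m (odd-below i<n))) eq)))
consecutive⇒halves {n = n} {i} {j} refl _ (inj₂ eq) =
  inj₂ (sym (ℕₚ.*-cancelˡ-≡ (suc j % n) i 2
    (trans (sym (double-mod (suc j) n)) (trans (%-congˡ (ℕₚ.*-suc 2 j)) eq))))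

halves⇒consecutive : ∀ {D n i j} .{{_ : NonZero D}} .{{_ : NonZero n}} → D ≡ 2 * n → i ℕ.< n →
  i ≡ j ⊎ i ≡ suc j % n → Consecutive D (2 * i) (suc (2 * j))
halves⇒consecutive refl i<n (inj₁ refl) = inj₁ (m<n⇒m%n≡m (odd-below i<n))
halves⇒consecutive {n = n} {j = j} refl _ (inj₂ refl) =
  inj₂ (trans (%-congˡ (sym (ℕₚ.*-suc 2 j))) (double-mod (suc j) n))

module _ {m : ℕ} (_~_ : Rel (Fin m) 0ℓ) where

  record DegreeTwo (u : Fin m) : Set where
    field
      left right : Fin m
      left-adj   : u ~ left
      right-adj  : u ~ right
      distinct   : left ≢ right
      only       : ∀ {t} → u ~ t → t ≡ left ⊎ t ≡ right

  record Cycle (D : ℕ) .{{_ : NonZero D}} : Set where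
    field
      vertex    : ℕ → Fin m
      injective : InjectiveBelow vertex D
      adjacent  : ∀ p → vertex p ~ vertex (suc p)
      edge      : ∀ {p q} → p ℕ.< D → q ℕ.< D → Consecutive D p q → vertex p ~ vertex q
      neighbour : ∀ {p t} → p ℕ.< D → vertex p ~ t →
                  ∃ λ q → q ℕ.< D × t ≡ vertex q × Consecutive D p q

  adjacent⇒consecutive : ∀ {D} .{{_ : NonZero D}} (C : Cycle D) {p q} → p ℕ.< D → q ℕ.< D →
    Cycle.vertex C p ~ Cycle.vertex C q → Consecutive D p q
  adjacent⇒consecutive {D} C {p} p<D q<D vp~vq with Cycle.neighbour C p<D vp~vq
  ... | q′ , q′<D , vq≡vq′ , consecutive =
    subst (Consecutive D p) (sym (Cycle.injective C q<D q′<D vq≡vq′)) consecutive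

-- In a finite graph (a symmetric irreflexive relation on Fin m) in which every
-- non-isolated vertex has degree two, every edge lies on a cycle which is a
-- whole connected component.  The cycle is traced by the non-backtracking
-- walk along the edge; it closes up at its first repeated vertex.
module TwoRegular {m : ℕ} (_~_ : Rel (Fin m) 0ℓ) (~-sym : Symmetric _~_)
  (~-irrefl : ∀ {u} → ¬ u ~ u) (degree-two : ∀ {u v} → u ~ v → DegreeTwo _~_ u) where

  only-neighbours : ∀ {u a b t} → u ~ a → u ~ b → a ≢ b → u ~ t → t ≡ a ⊎ t ≡ b
  only-neighbours u~a u~b a≢b u~t with degree-two u~a
  ... | N with DegreeTwo.only N u~a | DegreeTwo.only N u~b
  ...   | inj₁ refl | inj₁ refl = ⊥-elim (a≢b refl)
  ...   | inj₂ refl | inj₂ refl = ⊥-elim (a≢b refl)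
  ...   | inj₁ refl | inj₂ refl = DegreeTwo.only N u~t
  ...   | inj₂ refl | inj₁ refl = Sum.swap (DegreeTwo.only N u~t)

  other : ∀ {c} → DegreeTwo _~_ c → Fin m → Fin m
  other N p with p Finₚ.≟ DegreeTwo.left N
  ... | yes _ = DegreeTwo.right N
  ... | no _  = DegreeTwo.left N

  other-adj : ∀ {c} (N : DegreeTwo _~_ c) p → c ~ other N p
  other-adj N p with p Finₚ.≟ DegreeTwo.left N
  ... | yes _ = DegreeTwo.right-adj N
  ... | no _  = DegreeTwo.left-adj N

  other-new : ∀ {c} (N : DegreeTwo _~_ c) p → other N p ≢ p
  other-new N p with p Finₚ.≟ DegreeTwo.left N
  ... | yes p≡left = λ right≡p → DegreeTwo.distinct N (sym (trans right≡p p≡left))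
  ... | no p≢left  = λ left≡p → p≢left (sym left≡p)

  record Arc : Set where
    field
      from to : Fin m
      arc     : from ~ to

  advance : Arc → Arc
  advance a = record { from = to ; to = other N from ; arc = other-adj N from }
    where
    open Arc a
    N : DegreeTwo _~_ to
    N = degree-two (~-sym arc)

  module Walk {u v : Fin m} (u~v : u ~ v) where

    arcs : ℕ → Arc
    arcs zero    = record { from = u ; to = v ; arc = u~v }
    arcs (suc k) = advance (arcs k)

    w : ℕ → Fin m
    w k = Arc.from (arcs k)

    step : ∀ k → w k ~ w (suc k)
    step k = Arc.arc (arcs k)

    no-backtrack : ∀ k → w (suc (suc k)) ≢ w k
    no-backtrack k = other-new _ (w k)

    forced : ∀ k {t} → w (suc k) ~ t → t ≡ w k ⊎ t ≡ w (suc (suc k))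
    forced k = only-neighbours (~-sym (step k)) (step (suc k)) (λ eq → no-backtrack k (sym eq))

    returns : ∀ {i K} → InjectiveBelow w K → i ℕ.< K → w i ≡ w K → w K ≡ w 0
    returns {zero} _ _ w0≡wK = sym w0≡wK
    returns {suc i} {suc K} injective (s≤s i<K) eq
      with forced i (~-sym (subst (w K ~_) (sym eq) (step K)))
    ... | inj₁ wK≡wi = ⊥-elim (ℕₚ.<-irrefl (sym K≡i) i<K)
      where K≡i = injective (ℕₚ.n<1+n K) (ℕₚ.m<n⇒m<1+n i<K) wK≡wi
    ... | inj₂ wK≡w2+i with ℕₚ.m≤n⇒m<n∨m≡n i<K
    ...   | inj₁ 1+i<K = ⊥-elim (no-backtrack (suc i) (trans (cong (w ∘ suc) (sym K≡2+i)) (sym eq)))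
      where K≡2+i = injective (ℕₚ.n<1+n K) (s≤s 1+i<K) wK≡w2+i
    ...   | inj₂ refl  = ⊥-elim (~-irrefl (subst (_~ w (suc K)) eq (step (suc i))))

    module Closed (k : ℕ) (injective : InjectiveBelow w (3 + k)) (closes : w (3 + k) ≡ w 0) where

      D : ℕ
      D = 3 + k

      wrap : ∀ {p} → p ℕ.≤ D → w (p % D) ≡ w p
      wrap p≤D with ℕₚ.m≤n⇒m<n∨m≡n p≤D
      ... | inj₁ p<D = cong w (m<n⇒m%n≡m p<D)
      ... | inj₂ refl = trans (cong w (n%n≡0 D)) (sym closes)

      last-arc : w 0 ~ w (2 + k)
      last-arc = ~-sym (subst (w (2 + k) ~_) closes (step (2 + k)))

      edge : ∀ {p q} → p ℕ.< D → q ℕ.< D → Consecutive D p q → w p ~ w q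
      edge {p} p<D _ (inj₁ refl) = subst (w p ~_) (sym (wrap p<D)) (step p)
      edge {q = q} _ q<D (inj₂ refl) = ~-sym (subst (w q ~_) (sym (wrap q<D)) (step q))

      neighbour : ∀ {p t} → p ℕ.< D → w p ~ t → ∃ λ q → q ℕ.< D × t ≡ w q × Consecutive D p q
      neighbour {zero} _ w0~t with only-neighbours (step 0) last-arc w1≢w2+k w0~t
        where
        w1≢w2+k : w 1 ≢ w (2 + k)
        w1≢w2+k eq = ℕₚ.0≢1+n (ℕₚ.suc-injective (injective (s≤s (s≤s z≤n)) ℕₚ.≤-refl eq))
      ... | inj₁ refl = 1 , s≤s (s≤s z≤n) , refl , inj₁ refl
      ... | inj₂ refl = 2 + k , ℕₚ.≤-refl , refl , inj₂ (n%n≡0 D)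
      neighbour {suc p} p<D w-t with forced p w-t
      ... | inj₁ refl = p , ℕₚ.<-trans (ℕₚ.n<1+n p) p<D , refl , inj₂ (m<n⇒m%n≡m p<D)
      ... | inj₂ refl = suc (suc p) % D , m%n<n (suc (suc p)) D , sym (wrap p<D) , inj₁ refl

      cycle : Cycle _~_ D
      cycle = record { vertex = w ; injective = injective ; adjacent = step
                     ; edge = edge ; neighbour = neighbour }

  vertex-on-cycle : ∀ {u v} → u ~ v → ∃ λ k → Σ (Cycle _~_ (3 + k)) λ C → Cycle.vertex C 0 ≡ u
  vertex-on-cycle u~v = close (first-repeat w)
    where
    open Walk u~v
    LiesOnCycle : Set
    LiesOnCycle = ∃ λ k → Σ (Cycle _~_ (3 + k)) λ C → Cycle.vertex C 0 ≡ w 0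

    -- The walk closes up at its first repetition; a closed non-backtracking
    -- walk in a graph without loops has length at least 3.
    close-at : ∀ K → InjectiveBelow w K → w K ≡ w 0 → 0 ℕ.< K → LiesOnCycle
    close-at (suc zero) _ w1≡w0 _ = ⊥-elim (~-irrefl (subst (w 0 ~_) w1≡w0 (step 0)))
    close-at (suc (suc zero)) _ w2≡w0 _ = ⊥-elim (no-backtrack 0 w2≡w0)
    close-at (suc (suc (suc k))) injective closes _ = k , Closed.cycle k injective closes , refl
    close : FirstRepeat w → LiesOnCycle
    close R = close-at index injective (returns injective before revisits) (ℕₚ.≤-<-trans z≤n before)
      where open FirstRepeat R

module Ranked (P : FinitePoset) (rk : Notions.El P → ℕ) (isRk : Notions.IsRankFunction P rk) where
  open Notions P
  open IsDecPartialOrder isDecPartialOrder using (_≤?_; isPartialOrder)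
    renaming (refl to ≤-refl)

  <-trans : ∀ {x y z} → x < y → y < z → x < z
  <-trans = ToStrict.<-trans _≡_ _≤_ isPartialOrder

  _<?_ : ∀ x y → Dec (x < y)
  x <? y = (x ≤? y) ×-dec ¬? (x Finₚ.≟ y)

  -- A finite poset is well-founded in
  -- both directions; induct on the pair (top, bottom) lexicographically,
  -- splitting x < z at an intermediate element or finding that x ⋖ z.
  rank-increases : ∀ {x z} → x < z → rk x ℕ.< rk z
  rank-increases {x} {z} = go (po-wellFounded isPartialOrder z) (po-noetherian isPartialOrder x)
    where
    go : ∀ {x z} → Acc _<_ z → Acc (flip _<_) x → x < z → rk x ℕ.< rk z
    go {x} {z} acc-z@(acc below-z) acc-x@(acc above-x) x<z
      with Finₚ.any? (λ u → (x <? u) ×-dec (u <? z))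
    ... | yes (u , x<u , u<z) = ℕₚ.<-trans (go (below-z u<z) acc-x x<u) (go acc-z (above-x x<u) u<z)
    ... | no nothing-between =
      ℕₚ.≤-reflexive (sym (isRk x z (x<z , λ u x<u u<z → nothing-between (u , x<u , u<z))))

  rank-step⇒cover : ∀ {x z} → x < z → rk z ≡ suc (rk x) → x ⋖ z
  rank-step⇒cover x<z rk-z = x<z , λ u x<u u<z →
    ℕₚ.<⇒≱ (rank-increases x<u) (ℕₚ.≤-pred (subst (suc (rk u) ℕ.≤_) rk-z (rank-increases u<z)))

  interval : El → El → List El
  interval x y = filter (λ z → (x ≤? z) ×-dec (z ≤? y)) (allFin size)

  interval-unique : ∀ x y → Unique (interval x y)
  interval-unique x y = filter⁺ _ (allFin⁺ size)

  ∈-interval : ∀ {x y z} → x ≤ z → z ≤ y → z ∈ interval x y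
  ∈-interval x≤z z≤y = ∈-filter⁺ _ (∈-allFin _) (x≤z , z≤y)

  interval-∈ : ∀ {x y z} → z ∈ interval x y → x ≤ z × z ≤ y
  interval-∈ {x} {y} z∈ = proj₂ (∈-filter⁻ (λ z → (x ≤? z) ×-dec (z ≤? y)) {xs = allFin size} z∈)

  inside-length-two : ∀ {x a y} → x < a → a < y → rk y ≡ 2 + rk x → x ⋖ a × a ⋖ y
  inside-length-two {x} {a} {y} x<a a<y rk-y =
    rank-step⇒cover x<a rk-a , rank-step⇒cover a<y (trans rk-y (cong suc (sym rk-a)))
    where
    rk-a : rk a ≡ suc (rk x)
    rk-a = ℕₚ.≤-antisym (ℕₚ.≤-pred (subst (suc (rk a) ℕ.≤_) rk-y (rank-increases a<y)))
                        (rank-increases x<a)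

  length-two : Thin rk → ∀ x y → x ≤ y → rk y ≡ 2 + rk x → LengthTwoShape x y
  length-two thin x y x≤y rk-y
    with two-others (interval-unique x y) (thin x y x≤y rk-y)
                    (∈-interval ≤-refl x≤y) (∈-interval x≤y ≤-refl) x≢y
    where
    x≢y : x ≢ y
    x≢y refl = ℕₚ.<-irrefl rk-y (ℕₚ.m<n⇒m<1+n (ℕₚ.n<1+n (rk x)))
  ... | a , b , a≢b , (a∈ , a≢x , a≢y) , (b∈ , b≢x , b≢y) , classify =
    a , b , proj₁ a-covers , proj₂ a-covers , proj₁ b-covers , proj₂ b-covers , a≢b ,
    λ z (x≤z , z≤y) → classify (∈-interval x≤z z≤y)
    where
    inside : ∀ {c} → c ∈ interval x y → c ≢ x → c ≢ y → x ⋖ c × c ⋖ y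
    inside c∈ c≢x c≢y = let x≤c , c≤y = interval-∈ c∈
                        in inside-length-two (x≤c , ≢-sym c≢x) (c≤y , c≢y) rk-y
    a-covers : x ⋖ a × a ⋖ y
    a-covers = inside a∈ a≢x a≢y
    b-covers : x ⋖ b × b ⋖ y
    b-covers = inside b∈ b≢x b≢y

  module LengthThree (thin : Thin rk) (transitive : DiamondTransitive)
    {x y : El} (x≤y : x ≤ y) (rk-y : rk y ≡ 3 + rk x) where

    r : ℕ
    r = rk x

    Inner : El → Set
    Inner z = x < z × z < y

    inner-lower : ∀ {z} → Inner z → suc r ℕ.≤ rk z
    inner-lower (x<z , _) = rank-increases x<z

    inner-upper : ∀ {z} → Inner z → rk z ℕ.≤ 2 + r
    inner-upper {z} (_ , z<y) = ℕₚ.≤-pred (subst (suc (rk z) ℕ.≤_) rk-y (rank-increases z<y))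

    inner-rank : ∀ {z} → Inner z → rk z ≡ suc r ⊎ rk z ≡ 2 + r
    inner-rank iz with ℕₚ.m≤n⇒m<n∨m≡n (inner-lower iz)
    ... | inj₁ r+1<rk = inj₂ (ℕₚ.≤-antisym (inner-upper iz) r+1<rk)
    ... | inj₂ r+1≡rk = inj₁ (sym r+1≡rk)

    _~_ : Rel El 0ℓ
    u ~ v = Inner u × Inner v × (u ⋖ v ⊎ v ⋖ u)

    ~-sym : Symmetric _~_
    ~-sym (iu , iv , cover) = iv , iu , Sum.swap cover

    ~-irrefl : ∀ {u} → ¬ u ~ u
    ~-irrefl (_ , _ , inj₁ ((_ , u≢u) , _)) = u≢u refl
    ~-irrefl (_ , _ , inj₂ ((_ , u≢u) , _)) = u≢u refl

    ~-upward : ∀ {u v} → u ~ v → rk u ≡ suc r → u ⋖ v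
    ~-upward (_ , _ , inj₁ u⋖v) _ = u⋖v
    ~-upward {u} {v} (_ , iv , inj₂ v⋖u) rk-u = ⊥-elim (ℕₚ.1+n≰n (subst (suc r ℕ.≤_) rk-v (inner-lower iv)))
      where
      rk-v : rk v ≡ r
      rk-v = ℕₚ.suc-injective (trans (sym (isRk v u v⋖u)) rk-u)

    ~-downward : ∀ {u v} → u ~ v → rk u ≡ 2 + r → v ⋖ u
    ~-downward (_ , _ , inj₂ v⋖u) _ = v⋖u
    ~-downward {u} {v} (_ , iv , inj₁ u⋖v) rk-u = ⊥-elim (ℕₚ.1+n≰n (subst (ℕ._≤ 2 + r) rk-v (inner-upper iv)))
      where
      rk-v : rk v ≡ 3 + r
      rk-v = trans (isRk u v u⋖v) (cong suc rk-u)

    degree-two-up : ∀ {u} → Inner u → rk u ≡ suc r → DegreeTwo _~_ u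
    degree-two-up {u} iu@(x<u , u<y) rk-u =
      from-shape (length-two thin u y (proj₁ u<y) (trans rk-y (cong (2 +_) (sym rk-u))))
      where
      from-shape : LengthTwoShape u y → DegreeTwo _~_ u
      from-shape (c₁ , c₂ , u⋖c₁ , c₁⋖y , u⋖c₂ , c₂⋖y , c₁≢c₂ , classify) = record
        { left = c₁ ; right = c₂ ; distinct = c₁≢c₂
        ; left-adj = iu , inner-above u⋖c₁ c₁⋖y , inj₁ u⋖c₁
        ; right-adj = iu , inner-above u⋖c₂ c₂⋖y , inj₁ u⋖c₂
        ; only = only }
        where
        inner-above : ∀ {c} → u ⋖ c → c ⋖ y → Inner c
        inner-above u⋖c c⋖y = <-trans x<u (proj₁ u⋖c) , proj₁ c⋖y

        only : ∀ {t} → u ~ t → t ≡ c₁ ⊎ t ≡ c₂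
        only u~t@(_ , (_ , t≤y , t≢y) , _) with ~-upward u~t rk-u
        ... | (u≤t , u≢t) , _ with classify _ (u≤t , t≤y)
        ...   | inj₁ t≡u               = ⊥-elim (u≢t (sym t≡u))
        ...   | inj₂ (inj₁ t≡c₁)       = inj₁ t≡c₁
        ...   | inj₂ (inj₂ (inj₁ t≡c₂)) = inj₂ t≡c₂
        ...   | inj₂ (inj₂ (inj₂ t≡y)) = ⊥-elim (t≢y t≡y)

    degree-two-down : ∀ {u} → Inner u → rk u ≡ 2 + r → DegreeTwo _~_ u
    degree-two-down {u} iu@(x<u , u<y) rk-u = from-shape (length-two thin x u (proj₁ x<u) rk-u)
      where
      from-shape : LengthTwoShape x u → DegreeTwo _~_ u
      from-shape (a₁ , a₂ , x⋖a₁ , a₁⋖u , x⋖a₂ , a₂⋖u , a₁≢a₂ , classify) = record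
        { left = a₁ ; right = a₂ ; distinct = a₁≢a₂
        ; left-adj = iu , inner-below x⋖a₁ a₁⋖u , inj₂ a₁⋖u
        ; right-adj = iu , inner-below x⋖a₂ a₂⋖u , inj₂ a₂⋖u
        ; only = only }
        where
        inner-below : ∀ {a} → x ⋖ a → a ⋖ u → Inner a
        inner-below x⋖a a⋖u = proj₁ x⋖a , <-trans (proj₁ a⋖u) u<y

        only : ∀ {t} → u ~ t → t ≡ a₁ ⊎ t ≡ a₂
        only u~t@(_ , ((x≤t , x≢t) , _) , _) with ~-downward u~t rk-u
        ... | (t≤u , t≢u) , _ with classify _ (x≤t , t≤u)
        ...   | inj₁ t≡x               = ⊥-elim (x≢t (sym t≡x))
        ...   | inj₂ (inj₁ t≡a₁)       = inj₁ t≡a₁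
        ...   | inj₂ (inj₂ (inj₁ t≡a₂)) = inj₂ t≡a₂
        ...   | inj₂ (inj₂ (inj₂ t≡u)) = ⊥-elim (t≢u t≡u)

    degree-two : ∀ {u v} → u ~ v → DegreeTwo _~_ u
    degree-two (iu , _) = Sum.[ degree-two-up iu , degree-two-down iu ] (inner-rank iu)

    open TwoRegular _~_ ~-sym ~-irrefl degree-two using (vertex-on-cycle)

    Chain : El → Set
    Chain z = ∃₂ λ u v → x ⋖ u × u ⋖ v × v ⋖ y × (z ≡ u ⊎ z ≡ v)

    chain-through : ∀ {z} → Inner z → Chain z
    chain-through {z} (x<z , z<y) = Sum.[ through-atom , through-coatom ] (inner-rank (x<z , z<y))
      where
      through-atom : rk z ≡ suc r → Chain z
      through-atom rk-z =
        let c , _ , z⋖c , c⋖y , _ = length-two thin z y (proj₁ z<y) (trans rk-y (cong (2 +_) (sym rk-z)))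
        in z , c , rank-step⇒cover x<z rk-z , z⋖c , c⋖y , inj₁ refl

      through-coatom : rk z ≡ 2 + r → Chain z
      through-coatom rk-z =
        let a , _ , x⋖a , a⋖z , _ = length-two thin x z (proj₁ x<z) rk-z
        in a , z , x⋖a , a⋖z , rank-step⇒cover z<y (trans rk-y (cong suc (sym rk-z))) , inj₂ refl

    middle-edge : ∀ {u v} → x ⋖ u → u ⋖ v → v ⋖ y → u ~ v
    middle-edge x⋖u u⋖v v⋖y =
      (proj₁ x⋖u , <-trans (proj₁ u⋖v) (proj₁ v⋖y)) ,
      (<-trans (proj₁ x⋖u) (proj₁ u⋖v) , proj₁ v⋖y) , inj₁ u⋖v

    -- Since rk y - rk x = 3, y does not cover x, so [x, y] has an inner element.
    some-inner : ∃ Inner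
    some-inner = Sum.[ id , ⊥-elim ∘ not-cover ]′ between-or-cover
      where
      x<y : x < y
      x<y = x≤y , λ { refl → ℕₚ.m≢1+n+m r {2} rk-y }

      between-or-cover : ∃ Inner ⊎ x ⋖ y
      between-or-cover with Finₚ.any? (λ u → (x <? u) ×-dec (u <? y))
      ... | yes found = inj₁ found
      ... | no none   = inj₂ (x<y , λ u x<u u<y → none (u , x<u , u<y))

      not-cover : ¬ x ⋖ y
      not-cover x⋖y = ℕₚ.m≢1+n+m r {1} (ℕₚ.suc-injective (trans (sym (isRk x y x⋖y)) rk-y))

    module AlongCycle (k : ℕ) (C : Cycle _~_ (3 + k)) (rk-w₀ : rk (Cycle.vertex C 0) ≡ suc r) where
      open Cycle C renaming (vertex to w)

      D : ℕ
      D = 3 + k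

      inner : ∀ p → Inner (w p)
      inner p = proj₁ (adjacent p)

      rank-up : ∀ {p} → rk (w p) ≡ suc r → rk (w (suc p)) ≡ 2 + r
      rank-up {p} rk-p = trans (isRk _ _ (~-upward (adjacent p) rk-p)) (cong suc rk-p)

      rank-down : ∀ {p} → rk (w p) ≡ 2 + r → rk (w (suc p)) ≡ suc r
      rank-down {p} rk-p = ℕₚ.suc-injective (trans (sym (isRk _ _ (~-downward (adjacent p) rk-p))) rk-p)

      rank-even : ∀ i → rk (w (2 * i)) ≡ suc r
      rank-even zero    = rk-w₀
      rank-even (suc i) = subst (λ p → rk (w p) ≡ suc r) (sym (ℕₚ.*-suc 2 i)) (rank-down (rank-up (rank-even i)))

      rank-odd : ∀ i → rk (w (suc (2 * i))) ≡ 2 + r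
      rank-odd i = rank-up (rank-even i)

      atom : ∀ i → x ⋖ w (2 * i)
      atom i = rank-step⇒cover (proj₁ (inner (2 * i))) (rank-even i)

      coatom : ∀ i → w (suc (2 * i)) ⋖ y
      coatom i = rank-step⇒cover (proj₂ (inner (suc (2 * i)))) (trans rk-y (cong suc (sym (rank-odd i))))

      -- The cycle is bipartite between the two ranks, so its length is even;
      -- it is at least 3, hence 2n with n ≥ 2.
      even-length : ∃ λ m → D ≡ 2 * suc (suc m)
      even-length = halve (parity (2 + k))
        where
        closing : w (2 + k) ~ w 0
        closing = edge ℕₚ.≤-refl (s≤s z≤n) (inj₁ (n%n≡0 D))

        halve : (∃ λ i → 2 + k ≡ 2 * i ⊎ 2 + k ≡ suc (2 * i)) → ∃ λ m → D ≡ 2 * suc (suc m)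
        halve (i , inj₁ 2+k≡2i) = ⊥-elim (ℕₚ.m≢1+n+m (suc r) {0} (trans (sym rk-w₀) rk-w₀′))
          where
          rk-w₀′ : rk (w 0) ≡ 2 + r
          rk-w₀′ = trans (isRk _ _ (~-upward closing rk-last)) (cong suc rk-last)
            where
            rk-last : rk (w (2 + k)) ≡ suc r
            rk-last = subst (λ p → rk (w p) ≡ suc r) (sym 2+k≡2i) (rank-even i)
        halve (zero , inj₂ ())
        halve (suc m , inj₂ 2+k≡1+2i) = m , trans (cong suc 2+k≡1+2i) (sym (ℕₚ.*-suc 2 (suc m)))

      OnCycle : El → Set
      OnCycle z = ∃ λ q → q ℕ.< D × z ≡ w q

      on-cycle-inner : ∀ {z} → OnCycle z → Inner z
      on-cycle-inner (q , _ , refl) = inner q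

      on-cycle-neighbour : ∀ {u t} → OnCycle u → u ~ t → OnCycle t
      on-cycle-neighbour (p , p<D , refl) u~t =
        let q , q<D , t≡wq , _ = neighbour p<D u~t in q , q<D , t≡wq

      ThroughCycle : List El → Set
      ThroughCycle L = ∃₂ λ u v → L ≡ x ∷ u ∷ v ∷ y ∷ [] × OnCycle u × OnCycle v

      -- A diamond move preserves ThroughCycle: it replaces u or v by another
      -- graph neighbour of v or u.
      move-preserves : ∀ {L L′} → DiamondMove L L′ → ThroughCycle L → ThroughCycle L′
      move-preserves (move [] _ _ _ b _ (_ , _ , x⋖b , b⋖v , _)) (u , v , refl , on-u , on-v) =
        b , v , refl , on-cycle-neighbour on-v (~-sym (inner-b , inner-v , inj₁ b⋖v)) , on-v
        where
        inner-v : Inner v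
        inner-v = on-cycle-inner on-v
        inner-b : Inner b
        inner-b = proj₁ x⋖b , <-trans (proj₁ b⋖v) (proj₂ inner-v)
      move-preserves (move (_ ∷ []) _ _ _ b _ (_ , _ , u⋖b , b⋖y , _)) (u , v , refl , on-u , on-v) =
        u , b , refl , on-u , on-cycle-neighbour on-u (inner-u , inner-b , inj₁ u⋖b)
        where
        inner-u : Inner u
        inner-u = on-cycle-inner on-u
        inner-b : Inner b
        inner-b = <-trans (proj₁ inner-u) (proj₁ u⋖b) , proj₁ b⋖y
      move-preserves (move (_ ∷ _ ∷ []) _ _ _ _ _ _) (_ , _ , () , _)
      move-preserves (move (_ ∷ _ ∷ _ ∷ []) _ _ _ _ _ _) (_ , _ , () , _)
      move-preserves (move (_ ∷ _ ∷ _ ∷ _ ∷ []) _ _ _ _ _ _) (_ , _ , () , _)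
      move-preserves (move (_ ∷ _ ∷ _ ∷ _ ∷ _ ∷ _) _ _ _ _ _ _) (_ , _ , () , _)

      moves-preserve : ∀ {L L′} → Star DiamondMove L L′ → ThroughCycle L → ThroughCycle L′
      moves-preserve ε        through = through
      moves-preserve (m ◅ ms) through = moves-preserve ms (move-preserves m through)

      on-chain : ∀ {u v} → ThroughCycle (x ∷ u ∷ v ∷ y ∷ []) → OnCycle u × OnCycle v
      on-chain (_ , _ , refl , on-u , on-v) = on-u , on-v

      saturated : ∀ {u v} → x ⋖ u → u ⋖ v → v ⋖ y → IsSatChain x y (x ∷ u ∷ v ∷ y ∷ [])
      saturated x⋖u u⋖v v⋖y = step x⋖u (step u⋖v (step v⋖y (single y)))

      -- Diamond transitivity connects every saturated chain of [x, y] with the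
      -- chain x ⋖ w 0 ⋖ w 1 ⋖ y, so every inner element lies on the cycle.
      inner-on-cycle : ∀ {z} → Inner z → OnCycle z
      inner-on-cycle {z} iz =
        let u , v , x⋖u , u⋖v , v⋖y , z∈uv = chain-through iz
            moves = transitive x y x≤y _ _ along-cycle (saturated x⋖u u⋖v v⋖y)
            on-u , on-v = on-chain (moves-preserve moves through-w₀-w₁)
        in Sum.[ (λ z≡u → subst OnCycle (sym z≡u) on-u) , (λ z≡v → subst OnCycle (sym z≡v) on-v) ]′ z∈uv
        where
        along-cycle : IsSatChain x y (x ∷ w 0 ∷ w 1 ∷ y ∷ [])
        along-cycle = saturated (atom 0) (~-upward (adjacent 0) rk-w₀) (coatom 0)

        through-w₀-w₁ : ThroughCycle (x ∷ w 0 ∷ w 1 ∷ y ∷ [])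
        through-w₀-w₁ = w 0 , w 1 , refl , (0 , s≤s z≤n , refl) , (1 , s≤s (s≤s z≤n) , refl)

      module Shape (m : ℕ) (D≡2n : D ≡ 2 * suc (suc m)) where
        n : ℕ
        n = suc (suc m)

        a b : Fin n → El
        a i = w (2 * toℕ i)
        b i = w (suc (2 * toℕ i))

        even< : ∀ {i} → i ℕ.< n → 2 * i ℕ.< D
        even< {i} i<n = subst (2 * i ℕ.<_) (sym D≡2n) (ℕₚ.*-monoʳ-< 2 i<n)

        odd< : ∀ {i} → i ℕ.< n → suc (2 * i) ℕ.< D
        odd< {i} i<n = subst (suc (2 * i) ℕ.<_) (sym D≡2n) (odd-below i<n)

        halve : ∀ {q} → q ℕ.< D → (∃ λ i → q ≡ 2 * i ⊎ q ≡ suc (2 * i)) →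
          (∃ λ (i : Fin n) → q ≡ 2 * toℕ i) ⊎ (∃ λ (i : Fin n) → q ≡ suc (2 * toℕ i))
        halve q<D (i , inj₁ refl) = inj₁ (fromℕ< i<n , cong (2 *_) (sym (Finₚ.toℕ-fromℕ< i<n)))
          where
          i<n : i ℕ.< n
          i<n = ℕₚ.*-cancelˡ-< 2 i n (subst (2 * i ℕ.<_) D≡2n q<D)
        halve q<D (i , inj₂ refl) = inj₂ (fromℕ< i<n , cong (suc ∘ (2 *_)) (sym (Finₚ.toℕ-fromℕ< i<n)))
          where
          i<n : i ℕ.< n
          i<n = ℕₚ.*-cancelˡ-< 2 i n (ℕₚ.<-trans (ℕₚ.n<1+n (2 * i)) (subst (suc (2 * i) ℕ.<_) D≡2n q<D))

        classify : ∀ z → InInterval x y z → z ≡ x ⊎ z ≡ y ⊎ (∃ λ i → z ≡ a i) ⊎ (∃ λ i → z ≡ b i)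
        classify z (x≤z , z≤y) with z Finₚ.≟ x | z Finₚ.≟ y
        ... | yes z≡x | _       = inj₁ z≡x
        ... | no _    | yes z≡y = inj₂ (inj₁ z≡y)
        ... | no z≢x  | no z≢y  = inj₂ (inj₂ (on-cycle (inner-on-cycle ((x≤z , ≢-sym z≢x) , (z≤y , z≢y)))))
          where
          on-cycle : OnCycle z → (∃ λ i → z ≡ a i) ⊎ (∃ λ i → z ≡ b i)
          on-cycle (q , q<D , z≡wq) =
            Sum.map (Product.map₂ (λ q≡2i → trans z≡wq (cong w q≡2i)))
                    (Product.map₂ (λ q≡2i+1 → trans z≡wq (cong w q≡2i+1)))
                    (halve q<D (parity q))

        -- The conclusion of part (2): a i ⋖ b j iff 2i and 2j + 1 are
        -- neighbouring positions on the cycle.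
        shape : LengthThreeShape x y
        shape = m , a , b , a-injective , b-injective , a≢b , not-ends , atom ∘ toℕ , coatom ∘ toℕ ,
                covers⇒indices , indices⇒covers , classify
          where
          a-injective : ∀ i j → a i ≡ a j → i ≡ j
          a-injective i j ai≡aj = Finₚ.toℕ-injective (ℕₚ.*-cancelˡ-≡ (toℕ i) (toℕ j) 2
            (injective (even< (Finₚ.toℕ<n i)) (even< (Finₚ.toℕ<n j)) ai≡aj))

          b-injective : ∀ i j → b i ≡ b j → i ≡ j
          b-injective i j bi≡bj = Finₚ.toℕ-injective (ℕₚ.*-cancelˡ-≡ (toℕ i) (toℕ j) 2
            (ℕₚ.suc-injective (injective (odd< (Finₚ.toℕ<n i)) (odd< (Finₚ.toℕ<n j)) bi≡bj)))

          a≢b : ∀ i j → a i ≢ b j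
          a≢b i j ai≡bj = ℕₚ.m≢1+n+m (suc r) {0}
            (trans (sym (rank-even (toℕ i))) (trans (cong rk ai≡bj) (rank-odd (toℕ j))))

          not-ends : ∀ i → x ≢ a i × x ≢ b i × y ≢ a i × y ≢ b i
          not-ends i = proj₂ (proj₁ (inner _)) , proj₂ (proj₁ (inner _)) ,
                       ≢-sym (proj₂ (proj₂ (inner _))) , ≢-sym (proj₂ (proj₂ (inner _)))

          covers⇒indices : ∀ i j → a i ⋖ b j → toℕ i ≡ toℕ j ⊎ toℕ i ≡ suc (toℕ j) % n
          covers⇒indices i j ai⋖bj = consecutive⇒halves D≡2n (Finₚ.toℕ<n i)
            (adjacent⇒consecutive _~_ C (even< (Finₚ.toℕ<n i)) (odd< (Finₚ.toℕ<n j))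
                                  (inner _ , inner _ , inj₁ ai⋖bj))

          indices⇒covers : ∀ i j → toℕ i ≡ toℕ j ⊎ toℕ i ≡ suc (toℕ j) % n → a i ⋖ b j
          indices⇒covers i j indices = ~-upward
            (edge (even< (Finₚ.toℕ<n i)) (odd< (Finₚ.toℕ<n j)) (halves⇒consecutive D≡2n (Finₚ.toℕ<n i) indices))
            (rank-even (toℕ i))

    length-three : LengthThreeShape x y
    length-three =
      let u , v , x⋖u , u⋖v , v⋖y , _ = chain-through (proj₂ some-inner)
          k , C , w₀≡u = vertex-on-cycle (middle-edge x⋖u u⋖v v⋖y)
      in from-cycle k C (trans (cong rk w₀≡u) (isRk x u x⋖u))
      where
      from-cycle : ∀ k (C : Cycle _~_ (3 + k)) → rk (Cycle.vertex C 0) ≡ suc r → LengthThreeShape x y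
      from-cycle k C rk-w₀ = let m , D≡2n = even-length in Shape.shape m D≡2n
        where open AlongCycle k C rk-w₀

mainTheorem1 : (P : FinitePoset) → (rk : Notions.El P → ℕ) →
    Notions.IsRankFunction P rk → Notions.Thin P rk →
    Notions.DiamondTransitive P → Notions.Conclusion P rk
mainTheorem1 P rk isRk thin transitive =
  length-two thin , λ x y x≤y rk-y → LengthThree.length-three thin transitive x≤y rk-y
  where open Ranked P rk isRk
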